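{- Let $k\ge1$ be an integer and let $PT^*_k(z)=\sum_{i\ge0} p_i z^i$, where $p_i$ is the number of prefix grand $k$-Fibonacci paths of length $i$. Then \[ PT^*_k(z)=\frac{1-kz-z^2}{1-(k+3)z-(1-2k)z^2+2z^3}. \]
   Context: For a positive integer $k$, the $k$-Fibonacci numbers are defined by $F_{k,0}=0$, $F_{k,1}=1$, $F_{k,n+1}=kF_{k,n}+F_{k,n-1}$ for $n\ge1$. A prefix grand $k$-Fibonacci path of length $n$ is a lattice path in $\mathbb{Z}\times\mathbb{Z}$ starting at $(0,0)$ and ending at some point $(n,j)$ with $j\in\mathbb{Z}$ arbitrary (no restriction on going below the $x$-axis), built from rise steps $U=(1,1)$, fall steps $D=(1,-1)$, and horizontal steps $H_l=(l,0)$ for any positive integer $l$, where each step $H_l$ is additionally assigned one of $F_{k,l}$ colors (differently colored paths are counted as different). The empty path is the unique one of length $0$. -}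

module Defs where

open import Data.Nat using (ℕ; zero; suc; _+_; _*_)
open import Data.Fin using (Fin)
open import Data.Integer as ℤ using (ℤ; +_; -_)
open import Data.List using (List; []; _∷_)

F : ℕ → ℕ → ℕ
F k zero = 0
F k (suc zero) = 1
F k (suc (suc n)) = k * F k (suc n) + F k n

-- Prefix grand k-Fibonacci paths of length n (x-extent n), built step by step.
-- Steps: U = (1,1), D = (1,-1), H_l = (l,0) with l ≥ 1 carrying one of F k l colours.
-- Since the end height is arbitrary and the path may go below the x-axis,
-- heights impose no constraint, so a path is just its sequence of (coloured) steps.
-- The constructor  H l c p  represents the step H_(suc l) (coloured by c) followed by p.
data Path (k : ℕ) : ℕ → Set where
  []  : Path k 0
  U   : ∀ {n} → Path k n → Path k (suc n)
  D   : ∀ {n} → Path k n → Path k (suc n)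
  H   : ∀ {n} (l : ℕ) → Fin (F k (suc l)) → Path k n → Path k (suc l + n)

mulCoeff : List ℤ → (ℕ → ℤ) → ℕ → ℤ
mulCoeff [] a n = + 0
mulCoeff (d ∷ ds) a n = d ℤ.* a n ℤ.+ shifted n
  where
  shifted : ℕ → ℤ
  shifted zero = + 0
  shifted (suc m) = mulCoeff ds a m

polyCoeff : List ℤ → ℕ → ℤ
polyCoeff [] n = + 0
polyCoeff (c ∷ cs) zero = c
polyCoeff (c ∷ cs) (suc n) = polyCoeff cs n

numer : ℕ → List ℤ
numer k = + 1 ∷ - (+ k) ∷ - (+ 1) ∷ []

denom : ℕ → List ℤ
denom k = + 1 ∷ - (+ (k + 3)) ∷ - (+ 1 ℤ.- + (2 * k)) ∷ + 2 ∷ []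

-- Let q n count the paths of length n whose first step is horizontal. Removing the first
-- step gives p (n+1) = 2 p n + q (n+1). For q, a first step H_1 is simply removed, while the
-- F_{l+2} = k F_{l+1} + F_l colours of H_{l+2} let it be shortened either to H_{l+1}
-- (remembering one of k labels) or to H_l, so q (n+1) = p n + k q n + q (n-1). Eliminating q yields
-- p (n+3) = (k+3) p (n+2) + (1-2k) p (n+1) - 2 p n, so the denominator kills every
-- coefficient of index ≥ 3 and the first three coefficients give the numerator.
module Submission where

open import Defs
open import Data.Nat using (ℕ; _≤_; zero; suc; _+_; _*_)
open import Data.Nat.Properties using (*-zeroʳ; *-identityʳ; +-identityʳ)
open import Data.List using (List; []; _∷_)
open import Data.Fin using (Fin; zero)
open import Data.Fin.Properties using (0↔⊥; 1↔⊤; +↔⊎; *↔×)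
open import Data.Empty using (⊥)
open import Data.Unit using (⊤; tt)
open import Data.Sum using (_⊎_; inj₁; inj₂)
open import Data.Sum.Function.Propositional using (_⊎-↔_)
open import Data.Product using (Σ; _×_; _,_)
open import Data.Product.Function.NonDependent.Propositional using (_×-↔_)
open import Data.Integer using (ℤ; +_; -_)
import Data.Integer as ℤ
open import Data.Integer.Properties using (pos-+; pos-*)
open import Data.Integer.Tactic.RingSolver using (solve)
open import Function.Bundles using (_↔_; mk↔ₛ′; Inverse)
open import Function.Properties.Inverse using (↔-refl; ↔-sym; ↔-trans)
open import Function.Related.Propositional using (module EquationalReasoning)
open import Relation.Binary.PropositionalEquality using (_≡_; refl; sym; trans; cong; cong₂; subst)

module _ (k : ℕ) where

  data HPath : ℕ → Set where
    h : ∀ {m} (l : ℕ) → Fin (F k (suc l)) → Path k m → HPath (suc l + m)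

  HPath-pred : ℕ → Set
  HPath-pred zero = ⊥
  HPath-pred (suc n) = HPath n

  colour-split : ∀ l → Fin (F k (suc (suc l))) ↔ ((Fin k × Fin (F k (suc l))) ⊎ Fin (F k l))
  colour-split l = ↔-trans +↔⊎ (*↔× ⊎-↔ ↔-refl)

  Path-zero↔⊤ : Path k 0 ↔ ⊤
  Path-zero↔⊤ = mk↔ₛ′ (λ _ → tt) (λ _ → []) (λ _ → refl) (λ { [] → refl })

  HPath-zero↔⊥ : HPath 0 ↔ ⊥
  HPath-zero↔⊥ = mk↔ₛ′ (λ ()) (λ ()) (λ ()) (λ ())

  Path-suc↔ : ∀ n → Path k (suc n) ↔ (Path k n ⊎ (Path k n ⊎ HPath (suc n)))
  Path-suc↔ n = mk↔ₛ′ to from to∘from from∘to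
    where
    to : Path k (suc n) → Path k n ⊎ (Path k n ⊎ HPath (suc n))
    to (U x) = inj₁ x
    to (D x) = inj₂ (inj₁ x)
    to (H l c x) = inj₂ (inj₂ (h l c x))

    from : Path k n ⊎ (Path k n ⊎ HPath (suc n)) → Path k (suc n)
    from (inj₁ x) = U x
    from (inj₂ (inj₁ x)) = D x
    from (inj₂ (inj₂ (h l c x))) = H l c x

    to∘from : ∀ y → to (from y) ≡ y
    to∘from (inj₁ x) = refl
    to∘from (inj₂ (inj₁ x)) = refl
    to∘from (inj₂ (inj₂ (h l c x))) = refl

    from∘to : ∀ x → from (to x) ≡ x
    from∘to (U x) = refl
    from∘to (D x) = refl
    from∘to (H l c x) = refl

  HPath-suc↔ : ∀ n → HPath (suc n) ↔ (Path k n ⊎ ((Fin k × HPath n) ⊎ HPath-pred n))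
  HPath-suc↔ n = mk↔ₛ′ to from to∘from from∘to
    where
    module C l = Inverse (colour-split l)

    lengthen : ∀ {m} l → (Fin k × Fin (F k (suc l))) ⊎ Fin (F k l) → Path k m →
               (Fin k × HPath (suc l + m)) ⊎ HPath-pred (suc l + m)
    lengthen l (inj₁ (i , c)) x = inj₁ (i , h l c x)
    lengthen (suc l) (inj₂ c) x = inj₂ (h l c x)

    shorten : ∀ {n} → (Fin k × HPath n) ⊎ HPath-pred n → HPath (suc n)
    shorten (inj₁ (i , h l c x)) = h (suc l) (C.from l (inj₁ (i , c))) x
    shorten {suc n} (inj₂ (h l c x)) = h (suc (suc l)) (C.from (suc l) (inj₂ c)) x

    to : ∀ {n} → HPath (suc n) → Path k n ⊎ ((Fin k × HPath n) ⊎ HPath-pred n)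
    to (h zero zero x) = inj₁ x
    to (h (suc l) c x) = inj₂ (lengthen l (C.to l c) x)

    from : Path k n ⊎ ((Fin k × HPath n) ⊎ HPath-pred n) → HPath (suc n)
    from (inj₁ x) = h zero zero x
    from (inj₂ y) = shorten y

    to∘shorten : ∀ {n} (y : (Fin k × HPath n) ⊎ HPath-pred n) → to (shorten y) ≡ inj₂ y
    to∘shorten (inj₁ (i , h l c x)) = cong (λ s → inj₂ (lengthen l s x)) (C.strictlyInverseˡ l _)
    to∘shorten {suc n} (inj₂ (h l c x)) =
      cong (λ s → inj₂ (lengthen (suc l) s x)) (C.strictlyInverseˡ (suc l) _)

    shorten∘lengthen : ∀ {m} l s (x : Path k m) → shorten (lengthen l s x) ≡ h (suc l) (C.from l s) x
    shorten∘lengthen l (inj₁ (i , c)) x = refl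
    shorten∘lengthen (suc l) (inj₂ c) x = refl

    to∘from : ∀ y → to (from y) ≡ y
    to∘from (inj₁ x) = refl
    to∘from (inj₂ y) = to∘shorten y

    from∘to : ∀ x → from (to x) ≡ x
    from∘to (h zero zero x) = refl
    from∘to (h (suc l) c x) =
      trans (shorten∘lengthen l (C.to l c) x) (cong (λ c → h (suc l) c x) (C.strictlyInverseʳ l c))

  mutual
    paths : ℕ → ℕ
    paths zero = 1
    paths (suc n) = paths n + (paths n + hpaths (suc n))

    hpaths : ℕ → ℕ
    hpaths zero = 0
    hpaths (suc n) = paths n + (k * hpaths n + hpaths-pred n)

    hpaths-pred : ℕ → ℕ
    hpaths-pred zero = 0
    hpaths-pred (suc n) = hpaths n

  open EquationalReasoning

  mutual
    Path↔Fin : ∀ n → Path k n ↔ Fin (paths n)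
    Path↔Fin zero = ↔-trans Path-zero↔⊤ (↔-sym 1↔⊤)
    Path↔Fin (suc n) = begin
      Path k (suc n)
        ↔⟨ Path-suc↔ n ⟩
      (Path k n ⊎ (Path k n ⊎ HPath (suc n)))
        ↔⟨ Path↔Fin n ⊎-↔ (Path↔Fin n ⊎-↔ HPath↔Fin (suc n)) ⟩
      (Fin (paths n) ⊎ (Fin (paths n) ⊎ Fin (hpaths (suc n))))
        ↔⟨ ↔-refl ⊎-↔ +↔⊎ ⟨
      (Fin (paths n) ⊎ Fin (paths n + hpaths (suc n)))
        ↔⟨ +↔⊎ ⟨
      Fin (paths (suc n)) ∎

    HPath↔Fin : ∀ n → HPath n ↔ Fin (hpaths n)
    HPath↔Fin zero = ↔-trans HPath-zero↔⊥ (↔-sym 0↔⊥)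
    HPath↔Fin (suc n) = begin
      HPath (suc n)
        ↔⟨ HPath-suc↔ n ⟩
      (Path k n ⊎ ((Fin k × HPath n) ⊎ HPath-pred n))
        ↔⟨ Path↔Fin n ⊎-↔ ((↔-refl ×-↔ HPath↔Fin n) ⊎-↔ HPath-pred↔Fin n) ⟩
      (Fin (paths n) ⊎ ((Fin k × Fin (hpaths n)) ⊎ Fin (hpaths-pred n)))
        ↔⟨ ↔-refl ⊎-↔ (*↔× ⊎-↔ ↔-refl) ⟨
      (Fin (paths n) ⊎ (Fin (k * hpaths n) ⊎ Fin (hpaths-pred n)))
        ↔⟨ ↔-refl ⊎-↔ +↔⊎ ⟨
      (Fin (paths n) ⊎ Fin (k * hpaths n + hpaths-pred n))
        ↔⟨ +↔⊎ ⟨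
      Fin (hpaths (suc n)) ∎

    HPath-pred↔Fin : ∀ n → HPath-pred n ↔ Fin (hpaths-pred n)
    HPath-pred↔Fin zero = ↔-sym 0↔⊥
    HPath-pred↔Fin (suc n) = HPath↔Fin n

denomℤ : ℤ → List ℤ
denomℤ K = + 1 ∷ - (K ℤ.+ + 3) ∷ - (+ 1 ℤ.- + 2 ℤ.* K) ∷ + 2 ∷ []

denom≡denomℤ : ∀ k → denom k ≡ denomℤ (+ k)
denom≡denomℤ k = cong₂ (λ a b → + 1 ∷ - a ∷ - (+ 1 ℤ.- b) ∷ + 2 ∷ []) (pos-+ k 3) (pos-* 2 k)

-- The last shift inside mulCoeff is stuck on a variable index until n is split.
mulCoeff-singleton : ∀ d a n → mulCoeff (d ∷ []) a n ≡ d ℤ.* a n ℤ.+ + 0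
mulCoeff-singleton d a zero = refl
mulCoeff-singleton d a (suc n) = refl

-- The hypotheses are oriented so that matching on refl substitutes them away.
coupled-recurrence-annihilated : ∀ K p₀ q₁ q₂ {p₁ p₂ p₃ q₃ t} →
  p₁ ≡ p₀ ℤ.+ (p₀ ℤ.+ q₁) → p₂ ≡ p₁ ℤ.+ (p₁ ℤ.+ q₂) → p₃ ≡ p₂ ℤ.+ (p₂ ℤ.+ q₃) →
  q₃ ≡ p₂ ℤ.+ (K ℤ.* q₂ ℤ.+ q₁) → t ≡ + 2 ℤ.* p₀ ℤ.+ + 0 →
  + 1 ℤ.* p₃ ℤ.+ (- (K ℤ.+ + 3) ℤ.* p₂ ℤ.+ (- (+ 1 ℤ.- + 2 ℤ.* K) ℤ.* p₁ ℤ.+ t)) ≡ + 0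
coupled-recurrence-annihilated K p₀ q₁ q₂ refl refl refl refl refl =
  solve (K ∷ p₀ ∷ q₁ ∷ q₂ ∷ [])

first-coefficient : ∀ K {p₁} → p₁ ≡ + 3 → + 1 ℤ.* p₁ ℤ.+ (- (K ℤ.+ + 3) ℤ.* + 1 ℤ.+ + 0) ≡ - K
first-coefficient K refl = solve (K ∷ [])

second-coefficient : ∀ K {p₁ p₂} → p₁ ≡ + 3 → p₂ ≡ + 9 ℤ.+ K →
  + 1 ℤ.* p₂ ℤ.+ (- (K ℤ.+ + 3) ℤ.* p₁ ℤ.+ (- (+ 1 ℤ.- + 2 ℤ.* K) ℤ.* + 1 ℤ.+ + 0)) ≡ - + 1
second-coefficient K refl refl = solve (K ∷ [])

paths-one : ∀ k → paths k 1 ≡ 3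
paths-one k rewrite *-zeroʳ k = refl

paths-two : ∀ k → paths k 2 ≡ 9 + k
paths-two k rewrite *-zeroʳ k | *-identityʳ k | +-identityʳ k = refl

paths-suc-ℤ : ∀ k n → + paths k (suc n) ≡ + paths k n ℤ.+ (+ paths k n ℤ.+ + hpaths k (suc n))
paths-suc-ℤ k n = trans (pos-+ p (p + q)) (cong (λ x → + p ℤ.+ x) (pos-+ p q))
  where p = paths k n; q = hpaths k (suc n)

hpaths-suc-ℤ : ∀ k n →
  + hpaths k (suc (suc n)) ≡ + paths k (suc n) ℤ.+ (+ k ℤ.* + hpaths k (suc n) ℤ.+ + hpaths k n)
hpaths-suc-ℤ k n = trans (pos-+ p (k * q₁ + q₀))
  (cong (λ x → + p ℤ.+ x) (trans (pos-+ (k * q₁) q₀) (cong (ℤ._+ + q₀) (pos-* k q₁))))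
  where p = paths k (suc n); q₁ = hpaths k (suc n); q₀ = hpaths k n

paths-series : ∀ k n → mulCoeff (denom k) (λ i → + paths k i) n ≡ polyCoeff (numer k) n
paths-series k n =
  subst (λ d → mulCoeff d (λ i → + paths k i) n ≡ polyCoeff (numer k) n) (sym (denom≡denomℤ k)) (coeff n)
  where
  coeff : ∀ n → mulCoeff (denomℤ (+ k)) (λ i → + paths k i) n ≡ polyCoeff (numer k) n
  coeff 0 = refl
  coeff 1 = first-coefficient (+ k) {+ paths k 1} (cong +_ (paths-one k))
  coeff 2 = second-coefficient (+ k) {+ paths k 1} {+ paths k 2}
    (cong +_ (paths-one k)) (trans (cong +_ (paths-two k)) (pos-+ 9 k))
  coeff (suc (suc (suc n))) =
    coupled-recurrence-annihilated (+ k) (+ paths k n) (+ hpaths k (suc n)) (+ hpaths k (suc (suc n)))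
    (paths-suc-ℤ k n) (paths-suc-ℤ k (suc n)) (paths-suc-ℤ k (suc (suc n)))
    (hpaths-suc-ℤ k (suc n)) (mulCoeff-singleton (+ 2) (λ i → + paths k i) n)

theorem3p12 : (k : ℕ) → 1 ≤ k →
    Σ (ℕ → ℕ) (λ p →
    ((n : ℕ) → Path k n ↔ Fin (p n)) ×
    ((n : ℕ) → mulCoeff (denom k) (λ i → + (p i)) n ≡ polyCoeff (numer k) n))
theorem3p12 k _ = paths k , Path↔Fin k , paths-series k
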